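{- Let $q,r,m$ be nonnegative integers with $r\le m/2$ and $r\in\{q,q+1\}$. Then $a_{q+1}+\cdots+a_{m-r}\in\{s_0,s_1,\dots,s_m\}$ (an empty sum being the zero vector).
   Context: Let $c_i=1+t$ for $i\ge1$, where $2^t$ is the largest power of $2$ dividing $i$ (so $(c_i)$ begins $1,2,1,3,1,2,1,4,\dots$). Let $\mathbb{U}$ be the $\mathbb{F}_2$-vector space of binary sequences with finitely many $1$s and $e_j$ the vector whose only $1$ is in coordinate $j$. Put $a_i=e_{c_i}$ and $s_i=a_1+\cdots+a_i$ for $i\ge0$, with $s_0=0$. -}

module Defs where

open import Data.Nat using (ℕ; zero; suc; _+_; _∸_; _≡ᵇ_)
open import Data.Nat.DivMod using (_%_; _/_)
open import Data.Bool using (Bool; true; false; _xor_; if_then_else_)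

-- Elements of 𝕌 are represented as functions ℕ → Bool (coordinate j ↦ bit);
-- all vectors below have finite support. Equality of vectors is pointwise.
U : Set
U = ℕ → Bool

zeroU : U
zeroU _ = false

_⊕_ : U → U → U
(u ⊕ v) j = u j xor v j

e : ℕ → U
e j k = j ≡ᵇ k

-- ν₂ with fuel: largest t with 2^t ∣ n (for n ≥ 1, fuel ≥ n suffices)
ν₂-fuel : ℕ → ℕ → ℕ
ν₂-fuel zero    n = 0
ν₂-fuel (suc f) zero = 0
ν₂-fuel (suc f) (suc n) with suc n % 2
... | zero  = suc (ν₂-fuel f (suc n / 2))
... | suc _ = 0

ν₂ : ℕ → ℕ
ν₂ n = ν₂-fuel n n

c : ℕ → ℕ
c i = suc (ν₂ i)

a : ℕ → U
a i = e (c i)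

s : ℕ → U
s zero    = zeroU
s (suc i) = s i ⊕ a (suc i)

sumFrom : ℕ → ℕ → U
sumFrom i zero    = zeroU
sumFrom i (suc n) = a i ⊕ sumFrom (suc i) n

-- a_{lo} + ⋯ + a_{hi}  (zero if hi < lo)
sumRange : ℕ → ℕ → U
sumRange lo hi = sumFrom lo (suc hi ∸ lo)

-- s_n is the binary reflected Gray code of n: the coordinate t+1 of s_n is the bit t of n XOR n/2,
-- because a_i flips coordinate 1 + ν₂(i), exactly the bit a binary counter carries into at step i.
-- Hence s_x + s_y = s_k with k = x XOR y ≤ x + y; concretely, coordinate 1 of s_(2h+b) is
-- (h mod 2) + b and its coordinate t+2 is coordinate t+1 of s_h, so the index k is built by
-- induction from the one for ⌊x/2⌋ and ⌊y/2⌋. Finally a_{q+1} + ⋯ + a_{m-r} = s_q + s_{m-r} = s_k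
-- with k ≤ q + (m - r) ≤ m, since q ≤ r ≤ m - r.
module Submission where

open import Defs
open import Data.Nat using (ℕ; zero; suc; _+_; _*_; _∸_; _≤_; _<_; z≤n; s≤s; z<s)
open import Data.Nat.Properties
open import Data.Nat.DivMod using (_%_; _/_; m/n<m; m/n≡1+[m∸n]/n)
open import Data.Nat.Induction using (<-rec)
open import Data.Bool using (Bool; true; false; not; _xor_)
open import Data.Bool.Properties
  using (xor-assoc; xor-comm; xor-identityʳ; not-involutive; not-distribˡ-xor; xor-∧-commutativeRing)
open import Algebra.Bundles using (CommutativeRing)
open import Algebra.Properties.CommutativeSemigroup
  (CommutativeRing.+-commutativeSemigroup xor-∧-commutativeRing) using (interchange)
open import Data.Sum using (_⊎_; [_,_]′)
open import Data.Product using (Σ; _×_; _,_)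
open import Relation.Binary.PropositionalEquality
open ≡-Reasoning

double : ℕ → ℕ
double zero    = zero
double (suc h) = suc (suc (double h))

_*2+_ : ℕ → Bool → ℕ
h *2+ false = double h
h *2+ true  = suc (double h)

data BinaryView : ℕ → Set where
  bits : (h : ℕ) (b : Bool) → BinaryView (h *2+ b)

binaryView : ∀ n → BinaryView n
binaryView zero = bits zero false
binaryView (suc n) with binaryView n
... | bits h false = bits h true
... | bits h true  = bits (suc h) false

odd : ℕ → Bool
odd zero    = false
odd (suc n) = not (odd n)

odd-*2+ : ∀ h b → odd (h *2+ b) ≡ b
odd-*2+ zero    false = refl
odd-*2+ zero    true  = refl
odd-*2+ (suc h) false = trans (not-involutive _) (odd-*2+ h false)
odd-*2+ (suc h) true  = trans (not-involutive _) (odd-*2+ h true)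

≤-*2+ : ∀ h b → h ≤ h *2+ b
≤-*2+ zero    b     = z≤n
≤-*2+ (suc h) false = s≤s (m≤n⇒m≤1+n (≤-*2+ h false))
≤-*2+ (suc h) true  = s≤s (m≤n⇒m≤1+n (≤-*2+ h true))

suc-<-*2+ : ∀ h b → suc h < suc h *2+ b
suc-<-*2+ h false = s≤s (s≤s (≤-*2+ h false))
suc-<-*2+ h true  = s≤s (s≤s (≤-*2+ h true))

*2+-monoˡ-≤ : ∀ {k h} b → k ≤ h → k *2+ b ≤ h *2+ b
*2+-monoˡ-≤ false z≤n       = z≤n
*2+-monoˡ-≤ true  z≤n       = s≤s z≤n
*2+-monoˡ-≤ false (s≤s k≤h) = s≤s (s≤s (*2+-monoˡ-≤ false k≤h))
*2+-monoˡ-≤ true  (s≤s k≤h) = s≤s (s≤s (*2+-monoˡ-≤ true k≤h))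

*2+-xor-≤ : ∀ h h' b b' → (h + h') *2+ (b xor b') ≤ h *2+ b + h' *2+ b'
*2+-xor-≤ zero    h' false b'    = ≤-refl
*2+-xor-≤ zero    h' true  false = ≤-refl
*2+-xor-≤ zero    h' true  true  = m≤n+m (double h') 2
*2+-xor-≤ (suc h) h' false false = s≤s (s≤s (*2+-xor-≤ h h' false false))
*2+-xor-≤ (suc h) h' false true  = s≤s (s≤s (*2+-xor-≤ h h' false true))
*2+-xor-≤ (suc h) h' true  false = s≤s (s≤s (*2+-xor-≤ h h' true false))
*2+-xor-≤ (suc h) h' true  true  = s≤s (s≤s (*2+-xor-≤ h h' true true))

ν₂-fuel-irrelevant : ∀ f g n → n ≤ f → n ≤ g → ν₂-fuel f n ≡ ν₂-fuel g n
ν₂-fuel-irrelevant zero    zero    zero    _         _         = refl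
ν₂-fuel-irrelevant zero    (suc g) zero    _         _         = refl
ν₂-fuel-irrelevant (suc f) zero    zero    _         _         = refl
ν₂-fuel-irrelevant (suc f) (suc g) zero    _         _         = refl
ν₂-fuel-irrelevant (suc f) (suc g) (suc n) (s≤s n≤f) (s≤s n≤g) with suc n % 2
... | zero  = cong suc (ν₂-fuel-irrelevant f g (suc n / 2) (half≤ n≤f) (half≤ n≤g))
  where
  half≤ : ∀ {k} → n ≤ k → suc n / 2 ≤ k
  half≤ n≤k = ≤-trans (≤-pred (m/n<m (suc n) 2 (s≤s (s≤s z≤n)))) n≤k
... | suc _ = refl

ν₂-fuel-odd : ∀ f n → suc n % 2 ≡ 1 → ν₂-fuel (suc f) (suc n) ≡ 0
ν₂-fuel-odd f n odd-n with suc n % 2 | odd-n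
... | _ | refl = refl

ν₂-fuel-even : ∀ f n → suc n % 2 ≡ 0 → ν₂-fuel (suc f) (suc n) ≡ suc (ν₂-fuel f (suc n / 2))
ν₂-fuel-even f n even-n with suc n % 2 | even-n
... | _ | refl = refl

double%2≡0 : ∀ h → double h % 2 ≡ 0
double%2≡0 zero    = refl
double%2≡0 (suc h) = double%2≡0 h

suc-double%2≡1 : ∀ h → suc (double h) % 2 ≡ 1
suc-double%2≡1 zero    = refl
suc-double%2≡1 (suc h) = suc-double%2≡1 h

double/2≡h : ∀ h → double h / 2 ≡ h
double/2≡h zero    = refl
double/2≡h (suc h) = trans (m/n≡1+[m∸n]/n {double (suc h)} (s≤s (s≤s z≤n))) (cong suc (double/2≡h h))

c-odd : ∀ h → c (h *2+ true) ≡ 1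
c-odd h = cong suc (ν₂-fuel-odd (double h) (double h) (suc-double%2≡1 h))

c-even : ∀ h → c (suc h *2+ false) ≡ suc (c (suc h))
c-even h = cong suc (begin
  ν₂ (suc h *2+ false)                                  ≡⟨ ν₂-fuel-even (suc (double h)) (suc (double h)) (double%2≡0 h) ⟩
  suc (ν₂-fuel (suc (double h)) (double (suc h) / 2))   ≡⟨ cong (λ n → suc (ν₂-fuel (suc (double h)) n)) (double/2≡h (suc h)) ⟩
  suc (ν₂-fuel (suc (double h)) (suc h))                ≡⟨ cong suc (ν₂-fuel-irrelevant _ _ (suc h) (s≤s (≤-*2+ h false)) ≤-refl) ⟩
  suc (ν₂ (suc h))                                      ∎)

s-zero : ∀ n → s n 0 ≡ false
s-zero zero    = refl
s-zero (suc n) = trans (xor-identityʳ _) (s-zero n)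

s-suc-*2+ : ∀ h b → s (suc h *2+ b) ≗ s (h *2+ b) ⊕ (e 1 ⊕ e (suc (c (suc h))))
s-suc-*2+ h false j = begin
  (s (h *2+ false) j xor a (h *2+ true) j) xor a (suc h *2+ false) j
    ≡⟨ cong₂ (λ u v → (s (h *2+ false) j xor u) xor v)
             (cong (λ i → e i j) (c-odd h)) (cong (λ i → e i j) (c-even h)) ⟩
  (s (h *2+ false) j xor e 1 j) xor e (suc (c (suc h))) j
    ≡⟨ xor-assoc (s (h *2+ false) j) (e 1 j) (e (suc (c (suc h))) j) ⟩
  s (h *2+ false) j xor (e 1 j xor e (suc (c (suc h))) j) ∎
s-suc-*2+ h true j = begin
  (s (h *2+ true) j xor a (suc h *2+ false) j) xor a (suc h *2+ true) j
    ≡⟨ cong₂ (λ u v → (s (h *2+ true) j xor u) xor v)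
             (cong (λ i → e i j) (c-even h)) (cong (λ i → e i j) (c-odd (suc h))) ⟩
  (s (h *2+ true) j xor e (suc (c (suc h))) j) xor e 1 j
    ≡⟨ xor-assoc (s (h *2+ true) j) (e (suc (c (suc h))) j) (e 1 j) ⟩
  s (h *2+ true) j xor (e (suc (c (suc h))) j xor e 1 j)
    ≡⟨ cong (s (h *2+ true) j xor_) (xor-comm (e (suc (c (suc h))) j) (e 1 j)) ⟩
  s (h *2+ true) j xor (e 1 j xor e (suc (c (suc h))) j) ∎

s-*2+-one : ∀ h b → s (h *2+ b) 1 ≡ odd h xor b
s-*2+-one zero    false = refl
s-*2+-one zero    true  = refl
s-*2+-one (suc h) b     = begin
  s (suc h *2+ b) 1      ≡⟨ s-suc-*2+ h b 1 ⟩
  s (h *2+ b) 1 xor true ≡⟨ cong (_xor true) (s-*2+-one h b) ⟩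
  (odd h xor b) xor true ≡⟨ xor-comm _ true ⟩
  not (odd h xor b)      ≡⟨ not-distribˡ-xor (odd h) b ⟩
  not (odd h) xor b      ∎

s-*2+-shift : ∀ h b t → s (h *2+ b) (suc (suc t)) ≡ s h (suc t)
s-*2+-shift zero    false t = refl
s-*2+-shift zero    true  t = refl
s-*2+-shift (suc h) b     t =
  trans (s-suc-*2+ h b (suc (suc t))) (cong (_xor e (c (suc h)) (suc t)) (s-*2+-shift h b t))

-- The parity is carried along because coordinate 1 of s_(2h+b) is odd h xor b.
record SumWitness (x y : ℕ) : Set where
  constructor witness
  field
    index     : ℕ
    index-≤   : index ≤ x + y
    odd-index : odd index ≡ odd x xor odd y
    s-index   : s index ≗ s x ⊕ s y

*2+-witness : ∀ {h h'} b b' → SumWitness h h' → SumWitness (h *2+ b) (h' *2+ b')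
*2+-witness {h} {h'} b b' (witness k k≤h+h' odd-k s-k) =
  witness (k *2+ (b xor b'))
          (≤-trans (*2+-monoˡ-≤ (b xor b') k≤h+h') (*2+-xor-≤ h h' b b'))
          (trans (odd-*2+ k (b xor b')) (sym (cong₂ _xor_ (odd-*2+ h b) (odd-*2+ h' b'))))
          s-*2+
  where
  s-*2+ : s (k *2+ (b xor b')) ≗ s (h *2+ b) ⊕ s (h' *2+ b')
  s-*2+ zero = trans (s-zero (k *2+ (b xor b'))) (sym (cong₂ _xor_ (s-zero (h *2+ b)) (s-zero (h' *2+ b'))))
  s-*2+ (suc zero) = begin
    s (k *2+ (b xor b')) 1            ≡⟨ s-*2+-one k (b xor b') ⟩
    odd k xor (b xor b')              ≡⟨ cong (_xor (b xor b')) odd-k ⟩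
    (odd h xor odd h') xor (b xor b') ≡⟨ interchange (odd h) (odd h') b b' ⟩
    (odd h xor b) xor (odd h' xor b') ≡⟨ sym (cong₂ _xor_ (s-*2+-one h b) (s-*2+-one h' b')) ⟩
    s (h *2+ b) 1 xor s (h' *2+ b') 1 ∎
  s-*2+ (suc (suc t)) = begin
    s (k *2+ (b xor b')) (suc (suc t))                 ≡⟨ s-*2+-shift k (b xor b') t ⟩
    s k (suc t)                                        ≡⟨ s-k (suc t) ⟩
    s h (suc t) xor s h' (suc t)                       ≡⟨ sym (cong₂ _xor_ (s-*2+-shift h b t) (s-*2+-shift h' b' t)) ⟩
    s (h *2+ b) (suc (suc t)) xor s (h' *2+ b') (suc (suc t)) ∎

s-⊕-witness : ∀ x y → SumWitness x y
s-⊕-witness = <-rec (λ x → ∀ y → SumWitness x y) step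
  where
  step : ∀ x → (∀ {h} → h < x → ∀ y → SumWitness h y) → ∀ y → SumWitness x y
  step x rec y with binaryView x | binaryView y
  ... | bits zero    false | _          = witness y ≤-refl refl (λ _ → refl)
  ... | bits zero    true  | bits h' b' = *2+-witness true b' (rec z<s h')
  ... | bits (suc h) b     | bits h' b' = *2+-witness b b' (rec (suc-<-*2+ h b) h')

xor-cancelˡ : ∀ x y → x xor (x xor y) ≡ y
xor-cancelˡ false y = refl
xor-cancelˡ true  y = not-involutive y

s-+ : ∀ q n → s (q + n) ≗ s q ⊕ sumFrom (suc q) n
s-+ q zero    j = trans (cong (λ i → s i j) (+-identityʳ q)) (sym (xor-identityʳ (s q j)))
s-+ q (suc n) j = begin
  s (q + suc n) j                                         ≡⟨ cong (λ i → s i j) (+-suc q n) ⟩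
  s (suc q + n) j                                         ≡⟨ s-+ (suc q) n j ⟩
  (s q j xor a (suc q) j) xor sumFrom (suc (suc q)) n j   ≡⟨ xor-assoc (s q j) _ _ ⟩
  s q j xor (a (suc q) j xor sumFrom (suc (suc q)) n j)   ∎

sumRange-suc : ∀ {q n} → q ≤ n → sumRange (suc q) n ≗ s q ⊕ s n
sumRange-suc {q} {n} q≤n j = begin
  sumFrom (suc q) (n ∸ q) j                       ≡⟨ sym (xor-cancelˡ (s q j) _) ⟩
  s q j xor (s q j xor sumFrom (suc q) (n ∸ q) j) ≡⟨ cong (s q j xor_) (sym (s-+ q (n ∸ q) j)) ⟩
  s q j xor s (q + (n ∸ q)) j                     ≡⟨ cong (λ i → s q j xor s i j) (m+[n∸m]≡n q≤n) ⟩
  s q j xor s n j                                 ∎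

lemma4p6 : (q r m : ℕ) → 2 * r ≤ m → (r ≡ q ⊎ r ≡ suc q) →
    Σ ℕ (λ k → k ≤ m × ((j : ℕ) → sumRange (suc q) (m ∸ r) j ≡ s k j))
lemma4p6 q r m 2r≤m r≡q⊎1+q = index , index≤m , λ j → trans (sumRange-suc q≤m∸r j) (sym (s-index j))
  where
  open SumWitness (s-⊕-witness q (m ∸ r))
  q≤r : q ≤ r
  q≤r = [ (λ r≡q → ≤-reflexive (sym r≡q)) , (λ r≡1+q → subst (q ≤_) (sym r≡1+q) (n≤1+n q)) ]′ r≡q⊎1+q
  r≤m∸r : r ≤ m ∸ r
  r≤m∸r = m+n≤o⇒m≤o∸n r (subst (_≤ m) (cong (r +_) (+-identityʳ r)) 2r≤m)
  q≤m∸r : q ≤ m ∸ r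
  q≤m∸r = ≤-trans q≤r r≤m∸r
  r≤m : r ≤ m
  r≤m = ≤-trans r≤m∸r (m∸n≤m m r)
  index≤m : index ≤ m
  index≤m = ≤-trans index-≤ (≤-trans (+-monoˡ-≤ (m ∸ r) q≤r) (≤-reflexive (m+[n∸m]≡n r≤m)))
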